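{- (i) For $n\ge 3$, $\mathrm{gp}^-(C_n)=2$ if $n$ is even and $\mathrm{gp}^-(C_n)=3$ if $n$ is odd. (ii) If $t\ge 2$ and $r_1\ge \dots\ge r_t\ge 2$, then $\mathrm{gp}^-(K_{r_1,\dots,r_t})=\min\{t,r_t\}$.
   Context: $C_n$ is the cycle on $n$ vertices and $K_{r_1,\dots,r_t}$ the complete multipartite graph with parts of sizes $r_1,\dots,r_t$. A set $S$ of vertices of a connected graph $G$ is a general position set if no shortest path of $G$ contains three or more vertices of $S$; it is maximal if not properly contained in another general position set. $\mathrm{gp}^-(G)$ is the number of vertices in a smallest maximal general position set of $G$. -}

module Defs where

open import Data.Nat using (ℕ; zero; suc; _≤_)
open import Data.Fin using (Fin; toℕ)
open import Data.Fin.Subset using (Subset; _∈_; _⊆_; ∣_∣)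
open import Data.List using (List; []; _∷_; length)
open import Data.List.Relation.Unary.Linked using (Linked)
open import Data.List.Relation.Unary.Unique.Propositional using (Unique)
import Data.List.Membership.Propositional as L
open import Data.Product using (Σ; _×_; ∃)
open import Data.Sum using (_⊎_)
open import Data.Empty using (⊥)
open import Relation.Nullary using (¬_; does)
open import Relation.Binary.PropositionalEquality using (_≡_; _≢_)
open import Data.Vec using (tabulate)
import Data.Fin as F

Graph : ℕ → Set₁
Graph n = Fin n → Fin n → Set

end : ∀ {n} → Fin n → List (Fin n) → Fin n
end u []       = u
end u (x ∷ xs) = end x xs

-- u ∷ xs is a walk from u to w; its length (number of edges) is length xs
IsWalk : ∀ {n} → Graph n → Fin n → Fin n → List (Fin n) → Set
IsWalk G u w xs = Linked G (u ∷ xs) × end u xs ≡ w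

IsShortestPath : ∀ {n} → Graph n → Fin n → Fin n → List (Fin n) → Set
IsShortestPath G u w xs =
  IsWalk G u w xs × Unique (u ∷ xs) ×
  (∀ ys → IsWalk G u w ys → length xs ≤ length ys)

IsGeneralPosition : ∀ {n} → Graph n → Subset n → Set
IsGeneralPosition G S =
  ∀ u w xs → IsShortestPath G u w xs →
  ∀ a b c → a ≢ b → a ≢ c → b ≢ c →
  a ∈ S → b ∈ S → c ∈ S →
  a L.∈ (u ∷ xs) → b L.∈ (u ∷ xs) → c L.∈ (u ∷ xs) → ⊥

IsMaximalGP : ∀ {n} → Graph n → Subset n → Set
IsMaximalGP G S =
  IsGeneralPosition G S × (∀ T → IsGeneralPosition G T → S ⊆ T → T ⊆ S)

GpMinusIs : ∀ {n} → Graph n → ℕ → Set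
GpMinusIs G k =
  Σ _ (λ S → IsMaximalGP G S × ∣ S ∣ ≡ k) ×
  (∀ S → IsMaximalGP G S → k ≤ ∣ S ∣)

-- cycle C_n on vertices 0,…,n-1 with i ~ i+1 (mod n)
CycleStep : (n : ℕ) → Fin n → Fin n → Set
CycleStep n i j = suc (toℕ i) ≡ toℕ j ⊎ (suc (toℕ i) ≡ n × toℕ j ≡ 0)

Cycle : (n : ℕ) → Graph n
Cycle n i j = CycleStep n i j ⊎ CycleStep n j i

-- complete multipartite graph on Fin N whose vertex v lies in part p v
Multipartite : ∀ {N t} → (Fin N → Fin t) → Graph N
Multipartite p u v = p u ≢ p v

partSet : ∀ {N t} → (Fin N → Fin t) → Fin t → Subset N
partSet p i = tabulate (λ v → does (p v F.≟ i))

-- A set is in general position exactly when no member lies on a geodesic between two others,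
-- d x y + d y z = d x z: three vertices of a shortest path are ordered along it, and conversely
-- two geodesics x–y and y–z concatenate to a shortest x,z-path.
--
-- In C_2m the antipodal pair {0, m} is maximal, since every other vertex lies on one of the two
-- half-cycles joining it; in C_(2m+1) the same holds for {0, m, m+1}. No maximal set of C_(2m+1)
-- has only two vertices: every pair extends by a third vertex whose three distances x, y, m satisfy
-- x + y = m + 1, and such a triangle is never degenerate.
--
-- In a complete multipartite graph all distances are 1 or 2, so a set is in general position iff
-- it lies inside one part or meets every part at most once. A maximal set therefore contains a whole
-- part or meets every part, so it has at least min{t, r_t} vertices; a smallest part and a
-- transversal attain the two values.

module Submission where

open import Data.Bool using (true; false)
open import Data.Empty using (⊥; ⊥-elim)
open import Data.Fin using (Fin; zero; suc; toℕ)
import Data.Fin as F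
import Data.Fin.Properties as FP
open import Data.Fin.Subset using (Subset; _∈_; _⊆_; ⁅_⁆; _∪_; ∣_∣) renaming (⊥ to ∅)
open import Data.Fin.Subset.Properties
  using (_∈?_; x∈p∧x≢y⇒x∈p-y; x∈p⇒∣p-x∣<∣p∣; p─q⊆p; ∣p∣≤∣x∷p∣; p⊆q⇒∣p∣≤∣q∣; ∣⁅x⁆∣≡1;
         Empty-unique; ∣⊥∣≡0; x∈p∪q⁻; x∈p∪q⁺; ∉⊥; x∈⁅y⁆⇒x≡y; x∈⁅x⁆; p⊆p∪q)
open import Data.List using (List; []; _∷_; length; _++_; tabulate)
open import Data.List.Properties using (length-++; length-tabulate)
open import Data.List.Membership.Propositional.Properties using (∈-++⁺ˡ; ∈-tabulate⁺)
open import Data.List.Membership.Propositional.Properties.Core using (∉[])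
import Data.List.Membership.Propositional as L
open import Data.List.Relation.Unary.All using (All; []; _∷_)
import Data.List.Relation.Unary.All as All
import Data.List.Relation.Unary.All.Properties as All
open import Data.List.Relation.Unary.All.Properties.Core using (¬Any⇒All¬)
open import Data.List.Relation.Unary.AllPairs.Core using ([]; _∷_)
open import Data.List.Relation.Unary.Any using (here; there)
import Data.List.Relation.Unary.Any as Any
open import Data.List.Relation.Unary.Linked using (Linked; [-]; _∷_)
open import Data.List.Relation.Unary.Unique.Propositional using (Unique)
open import Data.List.Relation.Unary.Unique.Propositional.Properties using (tabulate⁺)
open import Data.Nat using (ℕ; zero; suc; _+_; _*_; _∸_; _⊓_; _%_; _/_; _≤_; _<_; z≤n; s≤s)
open import Data.Nat.DivMod using (m≡m%n+[m/n]*n)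
open import Data.Nat.Properties
open import Data.Nat.Tactic.RingSolver using (solve-∀)
open import Data.Product using (_×_; _,_; ∃; proj₁; proj₂)
open import Data.Sum using (_⊎_; inj₁; inj₂; swap)
open import Data.Vec using ([]; _∷_; there)
import Data.Vec as Vec
open import Data.Vec.Properties using (lookup∘tabulate; []=⇒lookup; lookup⇒[]=)
open import Function using (_∘_)
open import Relation.Binary.Definitions using (tri<; tri≈; tri>)
open import Relation.Binary.PropositionalEquality
  using (_≡_; _≢_; refl; sym; trans; cong; cong₂; subst; subst₂; ≢-sym; module ≡-Reasoning)
open import Relation.Nullary using (¬_; yes; no; Dec; does)
open import Relation.Nullary.Decidable using (_×-dec_; ¬?; decidable-stable; dec-true)
open import Relation.Unary using (Decidable)

open import Defs

pattern first  = here refl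
pattern second = there (here refl)
pattern third  = there (there (here refl))

-- Cardinality of subsets

_⊆ᴸ_ : ∀ {n} → Subset n → List (Fin n) → Set
p ⊆ᴸ xs = ∀ {x} → x ∈ p → x L.∈ xs

∣p∪q∣≤∣p∣+∣q∣ : ∀ {n} (p q : Subset n) → ∣ p ∪ q ∣ ≤ ∣ p ∣ + ∣ q ∣
∣p∪q∣≤∣p∣+∣q∣ []          []          = z≤n
∣p∪q∣≤∣p∣+∣q∣ (true ∷ p)  (s ∷ q)     = s≤s (≤-trans (∣p∪q∣≤∣p∣+∣q∣ p q) (+-monoʳ-≤ ∣ p ∣ (∣p∣≤∣x∷p∣ s q)))
∣p∪q∣≤∣p∣+∣q∣ (false ∷ p) (true ∷ q)  = ≤-trans (s≤s (∣p∪q∣≤∣p∣+∣q∣ p q)) (≤-reflexive (sym (+-suc ∣ p ∣ ∣ q ∣)))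
∣p∪q∣≤∣p∣+∣q∣ (false ∷ p) (false ∷ q) = ∣p∪q∣≤∣p∣+∣q∣ p q

length≤∣p∣ : ∀ {n} {p : Subset n} {xs} → Unique xs → All (_∈ p) xs → length xs ≤ ∣ p ∣
length≤∣p∣ []              []            = z≤n
length≤∣p∣ (x≢xs ∷ xs-uniq) (x∈p ∷ xs⊆p) =
  ≤-<-trans
    (length≤∣p∣ xs-uniq (All.zipWith (λ (y∈p , x≢y) → x∈p∧x≢y⇒x∈p-y y∈p (x≢y ∘ sym)) (xs⊆p , x≢xs)))
    (x∈p⇒∣p-x∣<∣p∣ x∈p)

-- Subset's _-_ is opened only locally: next to ℕ's ∣_-_∣, used for cycles, ∣ a - b ∣ would not parse.
module _ where
  open import Data.Fin.Subset using (_-_)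

  x∉p-x : ∀ {n} (p : Subset n) x → ¬ x ∈ p - x
  x∉p-x (_ ∷ p) (suc x) (there x∈p-x) = x∉p-x p x x∈p-x

  ∣p∣≤length : ∀ {n} {p : Subset n} xs → p ⊆ᴸ xs → ∣ p ∣ ≤ length xs
  ∣p∣≤length {n} {p} []       p⊆[] =
    ≤-reflexive (trans (cong ∣_∣ (Empty-unique (λ (_ , x∈p) → ∉[] (p⊆[] x∈p)))) (∣⊥∣≡0 n))
  ∣p∣≤length {p = p} (x ∷ xs) p⊆x∷xs = begin
    ∣ p ∣                 ≤⟨ p⊆q⇒∣p∣≤∣q∣ p⊆⁅x⁆∪p-x ⟩
    ∣ ⁅ x ⁆ ∪ (p - x) ∣   ≤⟨ ∣p∪q∣≤∣p∣+∣q∣ ⁅ x ⁆ (p - x) ⟩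
    ∣ ⁅ x ⁆ ∣ + ∣ p - x ∣ ≡⟨ cong (_+ ∣ p - x ∣) (∣⁅x⁆∣≡1 x) ⟩
    suc ∣ p - x ∣         ≤⟨ s≤s (∣p∣≤length xs p-x⊆xs) ⟩
    suc (length xs)       ∎
    where
    open ≤-Reasoning
    p⊆⁅x⁆∪p-x : p ⊆ ⁅ x ⁆ ∪ (p - x)
    p⊆⁅x⁆∪p-x {y} y∈p with y F.≟ x
    ... | yes refl = x∈p∪q⁺ (inj₁ (x∈⁅x⁆ x))
    ... | no  y≢x  = x∈p∪q⁺ (inj₂ (x∈p∧x≢y⇒x∈p-y y∈p y≢x))
    p-x⊆xs : (p - x) ⊆ᴸ xs
    p-x⊆xs {y} y∈p-x with p⊆x∷xs (p─q⊆p p ⁅ x ⁆ y∈p-x)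
    ... | here refl = ⊥-elim (x∉p-x p x y∈p-x)
    ... | there y∈xs = y∈xs

⊆ᴸ-or-∉ : ∀ {n} (p : Subset n) xs → p ⊆ᴸ xs ⊎ ∃ λ x → x ∈ p × ¬ x L.∈ xs
⊆ᴸ-or-∉ p xs with FP.any? (λ x → x ∈? p ×-dec ¬? (Any.any? (x F.≟_) xs))
... | yes x∈p∖xs = inj₂ x∈p∖xs
... | no  ∄x     = inj₁ λ {x} x∈p → decidable-stable (Any.any? (x F.≟_) xs) (λ x∉xs → ∄x (x , x∈p , x∉xs))

fromList : ∀ {n} → List (Fin n) → Subset n
fromList []       = ∅
fromList (x ∷ xs) = ⁅ x ⁆ ∪ fromList xs

∈-fromList⁺ : ∀ {n} {x : Fin n} {xs} → x L.∈ xs → x ∈ fromList xs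
∈-fromList⁺ (here refl)  = x∈p∪q⁺ (inj₁ (x∈⁅x⁆ _))
∈-fromList⁺ (there x∈xs) = x∈p∪q⁺ (inj₂ (∈-fromList⁺ x∈xs))

fromList⊆ᴸ : ∀ {n} (xs : List (Fin n)) → fromList xs ⊆ᴸ xs
fromList⊆ᴸ []       x∈∅ = ⊥-elim (∉⊥ x∈∅)
fromList⊆ᴸ (y ∷ xs) x∈  with x∈p∪q⁻ ⁅ y ⁆ (fromList xs) x∈
... | inj₁ x∈y  = here (x∈⁅y⁆⇒x≡y y x∈y)
... | inj₂ x∈xs = there (fromList⊆ᴸ xs x∈xs)

∣fromList∣ : ∀ {n} {xs : List (Fin n)} → Unique xs → ∣ fromList xs ∣ ≡ length xs
∣fromList∣ {xs = xs} unique =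
  ≤-antisym (∣p∣≤length xs (fromList⊆ᴸ xs)) (length≤∣p∣ unique (All.tabulate ∈-fromList⁺))

two-members : ∀ {n} {p : Subset n} → 2 ≤ ∣ p ∣ → ∃ λ a → ∃ λ b → a ∈ p × b ∈ p × a ≢ b
two-members {p = p} 2≤∣p∣ with ⊆ᴸ-or-∉ p []
... | inj₁ p⊆[] = ⊥-elim (<⇒≱ (≤-trans (s≤s z≤n) 2≤∣p∣) (∣p∣≤length [] p⊆[]))
... | inj₂ (a , a∈p , _) with ⊆ᴸ-or-∉ p (a ∷ [])
...   | inj₁ p⊆[a]             = ⊥-elim (<⇒≱ 2≤∣p∣ (∣p∣≤length (a ∷ []) p⊆[a]))
...   | inj₂ (b , b∈p , b∉[a]) = a , b , a∈p , b∈p , λ { refl → b∉[a] (here refl) }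

injective⇒≤∣p∣ : ∀ {k n} {p : Subset n} (f : Fin k → Fin n) → (∀ {i j} → f i ≡ f j → i ≡ j) →
  (∀ i → f i ∈ p) → k ≤ ∣ p ∣
injective⇒≤∣p∣ f f-injective f∈p =
  subst (_≤ _) (length-tabulate f) (length≤∣p∣ (tabulate⁺ f-injective) (All.tabulate⁺ f∈p))

decSubset : ∀ {n} {P : Fin n → Set} → Decidable P → Subset n
decSubset P? = Vec.tabulate (λ x → does (P? x))

∈-decSubset⁺ : ∀ {n} {P : Fin n → Set} (P? : Decidable P) {x} → P x → x ∈ decSubset P?
∈-decSubset⁺ P? {x} px = lookup⇒[]= x _ (trans (lookup∘tabulate _ x) (dec-true (P? x) px))

∈-decSubset⁻ : ∀ {n} {P : Fin n → Set} (P? : Decidable P) {x} → x ∈ decSubset P? → P x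
∈-decSubset⁻ P? {x} x∈P = dec-true⁻¹ (P? x) (trans (sym (lookup∘tabulate _ x)) ([]=⇒lookup x∈P))
  where
  dec-true⁻¹ : ∀ {A : Set} (a? : Dec A) → does a? ≡ true → A
  dec-true⁻¹ (yes a) _ = a

-- Walks

module _ {n : ℕ} (G : Graph n) where

  end-++ : ∀ u (xs ys : List (Fin n)) → end u (xs ++ ys) ≡ end (end u xs) ys
  end-++ u []       ys = refl
  end-++ u (x ∷ xs) ys = end-++ x xs ys

  end-∈ : ∀ u (xs : List (Fin n)) → end u xs L.∈ (u ∷ xs)
  end-∈ u []       = here refl
  end-∈ u (x ∷ xs) = there (end-∈ x xs)

  linked-++ : ∀ u xs ys → Linked G (u ∷ xs) → Linked G (end u xs ∷ ys) → Linked G (u ∷ xs ++ ys)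
  linked-++ u []       ys _                 linked-ys = linked-ys
  linked-++ u (x ∷ xs) ys (ux ∷ linked-xs) linked-ys = ux ∷ linked-++ x xs ys linked-xs linked-ys

  IsWalk-++ : ∀ {u v w} xs ys → IsWalk G u v xs → IsWalk G v w ys → IsWalk G u w (xs ++ ys)
  IsWalk-++ {u} xs ys (linked-xs , refl) (linked-ys , ys-end) =
    linked-++ u xs ys linked-xs linked-ys , trans (end-++ u xs ys) ys-end

  suffix-from : ∀ {u} x ys → u L.∈ (x ∷ ys) → Linked G (x ∷ ys) →
    ∃ λ zs → Linked G (u ∷ zs) × end u zs ≡ end x ys × length zs ≤ length ys
  suffix-from x ys       (here refl) linked      = ys , linked , refl , ≤-refl
  suffix-from x (y ∷ ys) (there u∈ys) (_ ∷ linked) with suffix-from y ys u∈ys linked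
  ... | zs , zs-linked , zs-end , zs≤ys = zs , zs-linked , zs-end , m≤n⇒m≤1+n zs≤ys

  path-or-shorter : ∀ u xs → Linked G (u ∷ xs) →
    Unique (u ∷ xs) ⊎ ∃ λ ys → Linked G (u ∷ ys) × end u ys ≡ end u xs × length ys < length xs
  path-or-shorter u []       _ = inj₁ ([] ∷ [])
  path-or-shorter u (x ∷ xs) (ux ∷ linked) with path-or-shorter x xs linked
  ... | inj₂ (ys , ys-linked , ys-end , ys<xs) = inj₂ (x ∷ ys , ux ∷ ys-linked , ys-end , s≤s ys<xs)
  ... | inj₁ x∷xs-unique with Any.any? (u F.≟_) (x ∷ xs)
  ...   | no  u∉x∷xs = inj₁ (¬Any⇒All¬ (x ∷ xs) u∉x∷xs ∷ x∷xs-unique)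
  ...   | yes u∈x∷xs with suffix-from x xs u∈x∷xs linked
  ...     | zs , zs-linked , zs-end , zs≤xs = inj₂ (zs , zs-linked , zs-end , s≤s zs≤xs)

  shortest-walk⇒unique : ∀ {u w} xs → IsWalk G u w xs →
    (∀ ys → IsWalk G u w ys → length xs ≤ length ys) → Unique (u ∷ xs)
  shortest-walk⇒unique {u} xs (linked , xs-end) shortest with path-or-shorter u xs linked
  ... | inj₁ unique = unique
  ... | inj₂ (ys , ys-linked , ys-end , ys<xs) = ⊥-elim (<⇒≱ ys<xs (shortest ys (ys-linked , trans ys-end xs-end)))

-- Maximal general position sets

gp-⊆ᴸ-pair : ∀ {n} {G : Graph n} {S x y} → S ⊆ᴸ (x ∷ y ∷ []) → IsGeneralPosition G S
gp-⊆ᴸ-pair S⊆xy _ _ _ _ a b c a≢b a≢c b≢c a∈S b∈S c∈S _ _ _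
  with S⊆xy a∈S | S⊆xy b∈S | S⊆xy c∈S
... | first  | first  | _      = a≢b refl
... | second | second | _      = a≢b refl
... | first  | _      | first  = a≢c refl
... | second | _      | second = a≢c refl
... | _      | first  | first  = b≢c refl
... | _      | second | second = b≢c refl

other-vertex : ∀ {n} → 2 ≤ n → (a : Fin n) → ∃ (_≢ a)
other-vertex (s≤s (s≤s _)) zero    = suc zero , λ ()
other-vertex (s≤s (s≤s _)) (suc _) = zero , λ ()

maximal-absorbs : ∀ {n} {G : Graph n} {S v} → IsMaximalGP G S → IsGeneralPosition G (S ∪ ⁅ v ⁆) → v ∈ S
maximal-absorbs {S = S} {v} (_ , maximal) gp =
  maximal (S ∪ ⁅ v ⁆) gp (p⊆p∪q ⁅ v ⁆) (x∈p∪q⁺ (inj₂ (x∈⁅x⁆ v)))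

maximal-grows : ∀ {n} {G : Graph n} {S c xs} → IsMaximalGP G S → ¬ c L.∈ xs →
  (∀ {T} → T ⊆ᴸ (c ∷ xs) → IsGeneralPosition G T) → ∃ λ x → x ∈ S × ¬ x L.∈ xs
maximal-grows {S = S} {c} {xs} maxS c∉xs gp with ⊆ᴸ-or-∉ S xs
... | inj₂ new  = new
... | inj₁ S⊆xs = ⊥-elim (c∉xs (S⊆xs (maximal-absorbs maxS (gp S∪c⊆c∷xs))))
  where
  S∪c⊆c∷xs : (S ∪ ⁅ c ⁆) ⊆ᴸ (c ∷ xs)
  S∪c⊆c∷xs x∈S∪c with x∈p∪q⁻ S ⁅ c ⁆ x∈S∪c
  ... | inj₁ x∈S = there (S⊆xs x∈S)
  ... | inj₂ x∈c = here (x∈⁅y⁆⇒x≡y c x∈c)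

maximal-pair : ∀ {n} {G : Graph n} {S} → 2 ≤ n → IsMaximalGP G S →
  ∃ λ a → ∃ λ b → a ∈ S × b ∈ S × a ≢ b
maximal-pair 2≤n@(s≤s (s≤s _)) maxS
  with maximal-grows {c = zero} {xs = []} maxS ∉[]
         (λ T⊆[0] → gp-⊆ᴸ-pair {x = zero} {y = zero} (λ x∈T → there (T⊆[0] x∈T)))
... | a , a∈S , _
  with other-vertex 2≤n a
... | b , b≢a
  with maximal-grows {c = b} {xs = a ∷ []} maxS (λ { first → b≢a refl }) gp-⊆ᴸ-pair
... | b′ , b′∈S , b′∉[a] = a , b′ , a∈S , b′∈S , λ { refl → b′∉[a] first }

maximal-≥2 : ∀ {n} {G : Graph n} {S} → 2 ≤ n → IsMaximalGP G S → 2 ≤ ∣ S ∣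
maximal-≥2 2≤n maxS with maximal-pair 2≤n maxS
... | a , b , a∈S , b∈S , a≢b = length≤∣p∣ ((a≢b ∷ []) ∷ [] ∷ []) (a∈S ∷ b∈S ∷ [])

maximal-≥3 : ∀ {n} {G : Graph n} {S} → 2 ≤ n →
  (∀ {a b} → a ≢ b →
     ∃ λ c → c ≢ a × c ≢ b × ∀ {T} → T ⊆ᴸ (a ∷ b ∷ c ∷ []) → IsGeneralPosition G T) →
  IsMaximalGP G S → 3 ≤ ∣ S ∣
maximal-≥3 2≤n third-vertex maxS with maximal-pair 2≤n maxS
... | a , b , a∈S , b∈S , a≢b with third-vertex a≢b
... | c , c≢a , c≢b , gp
  with maximal-grows {c = c} {xs = a ∷ b ∷ []} maxS (λ { first → c≢a refl ; second → c≢b refl })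
         (λ T⊆cab → gp (λ x∈T → rotate (T⊆cab x∈T)))
  where
  rotate : ∀ {x} → x L.∈ (c ∷ a ∷ b ∷ []) → x L.∈ (a ∷ b ∷ c ∷ [])
  rotate first  = third
  rotate second = first
  rotate third  = second
... | x , x∈S , x∉ab =
  length≤∣p∣ ((a≢b ∷ (λ { refl → x∉ab first }) ∷ []) ∷ ((λ { refl → x∉ab second }) ∷ []) ∷ [] ∷ [])
             (a∈S ∷ b∈S ∷ x∈S ∷ [])

-- Graphs with a distance function

NondegenerateTriangle : ℕ → ℕ → ℕ → Set
NondegenerateTriangle a b c = a ≢ b + c × b ≢ a + c × c ≢ a + b

module GraphDistance {n : ℕ} (G : Graph n) (d : Fin n → Fin n → ℕ)
  (d≤length : ∀ {u w} xs → IsWalk G u w xs → d u w ≤ length xs)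
  (walk≤d : ∀ u w → ∃ λ xs → IsWalk G u w xs × length xs ≤ d u w) where

  d-refl : ∀ u → d u u ≡ 0
  d-refl u = n≤0⇒n≡0 (d≤length [] ([-] , refl))

  d≡0⇒≡ : ∀ {u w} → d u w ≡ 0 → u ≡ w
  d≡0⇒≡ {u} {w} d≡0 with walk≤d u w
  ... | []    , (_ , u≡w) , _ = u≡w
  ... | _ ∷ _ , _ , len≤d with subst (_ ≤_) d≡0 len≤d
  ...   | ()

  triangle : ∀ u v w → d u w ≤ d u v + d v w
  triangle u v w with walk≤d u v | walk≤d v w
  ... | xs , xs-walk , xs≤d | ys , ys-walk , ys≤d = begin
    d u w                 ≤⟨ d≤length (xs ++ ys) (IsWalk-++ G xs ys xs-walk ys-walk) ⟩
    length (xs ++ ys)     ≡⟨ length-++ xs ⟩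
    length xs + length ys ≤⟨ +-mono-≤ xs≤d ys≤d ⟩
    d u v + d v w         ∎
    where open ≤-Reasoning

  d-step : ∀ {u x} w → G u x → d u w ≤ suc (d x w)
  d-step {u} {x} w ux with walk≤d x w
  ... | xs , (linked , xs-end) , xs≤d = ≤-trans (d≤length (x ∷ xs) (ux ∷ linked , xs-end)) (s≤s xs≤d)

  Geodesic : Fin n → Fin n → List (Fin n) → Set
  Geodesic u w xs = IsWalk G u w xs × length xs ≡ d u w

  shortest⇒geodesic : ∀ {u w xs} → IsShortestPath G u w xs → Geodesic u w xs
  shortest⇒geodesic {u} {w} {xs} (xs-walk , _ , shortest) with walk≤d u w
  ... | ys , ys-walk , ys≤d = xs-walk , ≤-antisym (≤-trans (shortest ys ys-walk) ys≤d) (d≤length xs xs-walk)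

  geodesic-tail : ∀ {u w x xs} → Geodesic u w (x ∷ xs) → Geodesic x w xs
  geodesic-tail {u} {w} {x} {xs} ((ux ∷ linked , xs-end) , len≡d) =
    (linked , xs-end) ,
    ≤-antisym (≤-pred (subst (_≤ suc (d x w)) (sym len≡d) (d-step w ux))) (d≤length xs (linked , xs-end))

  Between : Fin n → Fin n → Fin n → Set
  Between x y z = d x y + d y z ≡ d x z

  geodesic-between : ∀ {u w} xs → Geodesic u w xs → ∀ {a} → a L.∈ (u ∷ xs) → Between u a w
  geodesic-between {u} {w} xs       _ (here refl) = cong (_+ d u w) (d-refl u)
  geodesic-between {u} {w} (x ∷ xs) geo@((ux ∷ _ , _) , len≡d) {a} (there a∈xs) =
    ≤-antisym
      (begin
        d u a + d a w       ≤⟨ +-monoˡ-≤ (d a w) (d-step a ux) ⟩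
        suc (d x a + d a w) ≡⟨ cong suc (geodesic-between xs (geodesic-tail geo) a∈xs) ⟩
        suc (d x w)         ≡⟨ cong suc (sym (proj₂ (geodesic-tail geo))) ⟩
        suc (length xs)     ≡⟨ len≡d ⟩
        d u w               ∎)
      (triangle u a w)
    where open ≤-Reasoning

  geodesic-ordered : ∀ {u w} xs → Geodesic u w xs → ∀ {a b} → a L.∈ (u ∷ xs) → b L.∈ (u ∷ xs) →
    Between a b w ⊎ Between b a w
  geodesic-ordered xs       geo (here refl)  b∈u∷xs      = inj₁ (geodesic-between xs geo b∈u∷xs)
  geodesic-ordered xs       geo (there a∈xs) (here refl)  = inj₂ (geodesic-between xs geo (there a∈xs))
  geodesic-ordered (x ∷ xs) geo (there a∈xs) (there b∈xs) = geodesic-ordered xs (geodesic-tail geo) a∈xs b∈xs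

  -- In the second case the three relations add up to d z x + d x y + d y z = 0.
  between-towards : ∀ {x y z w} → Between x y w → Between y z w → Between x z w ⊎ Between z x w →
    x ≢ y → Between x y z
  between-towards {x} {y} {z} {w} xyw yzw (inj₁ xzw) _ = +-cancelʳ-≡ (d z w) (d x y + d y z) (d x z) (begin
    d x y + d y z + d z w   ≡⟨ +-assoc (d x y) (d y z) (d z w) ⟩
    d x y + (d y z + d z w) ≡⟨ cong (d x y +_) yzw ⟩
    d x y + d y w           ≡⟨ xyw ⟩
    d x w                   ≡⟨ sym xzw ⟩
    d x z + d z w           ∎)
    where open ≡-Reasoning
  between-towards {x} {y} {z} {w} xyw yzw (inj₂ zxw) x≢y =
    ⊥-elim (x≢y (d≡0⇒≡ (m+n≡0⇒n≡0 (d z x) (m+n≡0⇒m≡0 (d z x + d x y) cycle≡0))))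
    where
    open ≡-Reasoning
    cycle≡0 : d z x + d x y + d y z ≡ 0
    cycle≡0 = +-cancelʳ-≡ (d z w) (d z x + d x y + d y z) 0 (begin
      d z x + d x y + d y z + d z w   ≡⟨ +-assoc (d z x + d x y) (d y z) (d z w) ⟩
      d z x + d x y + (d y z + d z w) ≡⟨ cong (d z x + d x y +_) yzw ⟩
      d z x + d x y + d y w           ≡⟨ +-assoc (d z x) (d x y) (d y w) ⟩
      d z x + (d x y + d y w)         ≡⟨ cong (d z x +_) xyw ⟩
      d z x + d x w                   ≡⟨ zxw ⟩
      d z w                           ∎)

  NoneBetween : Subset n → Set
  NoneBetween S = ∀ {x y z} → x ∈ S → y ∈ S → z ∈ S → x ≢ y → x ≢ z → y ≢ z → ¬ Between x y z

  none-between⇒gp : ∀ S → NoneBetween S → IsGeneralPosition G S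
  none-between⇒gp S none u w xs shortest a b c a≢b a≢c b≢c a∈S b∈S c∈S a∈xs b∈xs c∈xs =
    order (ordered a∈xs b∈xs) (ordered b∈xs c∈xs) (ordered a∈xs c∈xs)
    where
    ordered : ∀ {a b} → a L.∈ (u ∷ xs) → b L.∈ (u ∷ xs) → Between a b w ⊎ Between b a w
    ordered = geodesic-ordered xs (shortest⇒geodesic shortest)
    order : Between a b w ⊎ Between b a w → Between b c w ⊎ Between c b w → Between a c w ⊎ Between c a w → ⊥
    order (inj₁ abw) (inj₁ bcw) acw = none a∈S b∈S c∈S a≢b a≢c b≢c (between-towards abw bcw acw a≢b)
    order (inj₁ abw) (inj₂ cbw) (inj₁ acw) =
      none a∈S c∈S b∈S a≢c a≢b (≢-sym b≢c) (between-towards acw cbw (inj₁ abw) a≢c)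
    order (inj₁ abw) (inj₂ cbw) (inj₂ caw) =
      none c∈S a∈S b∈S (≢-sym a≢c) (≢-sym b≢c) a≢b (between-towards caw abw (inj₁ cbw) (≢-sym a≢c))
    order (inj₂ baw) (inj₁ bcw) (inj₁ acw) =
      none b∈S a∈S c∈S (≢-sym a≢b) b≢c a≢c (between-towards baw acw (inj₁ bcw) (≢-sym a≢b))
    order (inj₂ baw) (inj₁ bcw) (inj₂ caw) =
      none b∈S c∈S a∈S b≢c (≢-sym a≢b) (≢-sym a≢c) (between-towards bcw caw (inj₁ baw) b≢c)
    order (inj₂ baw) (inj₂ cbw) acw =
      none c∈S b∈S a∈S (≢-sym b≢c) (≢-sym a≢c) (≢-sym a≢b) (between-towards cbw baw (swap acw) (≢-sym b≢c))

  gp⇒none-between : ∀ {S} → IsGeneralPosition G S → NoneBetween S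
  gp⇒none-between gp {x} {y} {z} x∈S y∈S z∈S x≢y x≢z y≢z xyz with walk≤d x y | walk≤d y z
  ... | xs , xs-walk , xs≤d | ys , ys-walk , ys≤d =
    gp x z (xs ++ ys) (walk , shortest-walk⇒unique G (xs ++ ys) walk shortest , shortest)
       x y z x≢y x≢z y≢z x∈S y∈S z∈S
       (here refl)
       (subst (L._∈ (x ∷ xs ++ ys)) (proj₂ xs-walk) (∈-++⁺ˡ (end-∈ G x xs)))
       (subst (L._∈ (x ∷ xs ++ ys)) (proj₂ walk) (end-∈ G x (xs ++ ys)))
    where
    walk : IsWalk G x z (xs ++ ys)
    walk = IsWalk-++ G xs ys xs-walk ys-walk
    shortest : ∀ zs → IsWalk G x z zs → length (xs ++ ys) ≤ length zs
    shortest zs zs-walk = begin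
      length (xs ++ ys)     ≡⟨ length-++ xs ⟩
      length xs + length ys ≤⟨ +-mono-≤ xs≤d ys≤d ⟩
      d x y + d y z         ≡⟨ xyz ⟩
      d x z                 ≤⟨ d≤length zs zs-walk ⟩
      length zs             ∎
      where open ≤-Reasoning

  between-sym : (∀ u v → d u v ≡ d v u) → ∀ {x y z} → Between x y z → Between z y x
  between-sym d-sym {x} {y} {z} xyz = begin
    d z y + d y x ≡⟨ cong₂ _+_ (d-sym z y) (d-sym y x) ⟩
    d y z + d x y ≡⟨ +-comm (d y z) (d x y) ⟩
    d x y + d y z ≡⟨ xyz ⟩
    d x z         ≡⟨ d-sym x z ⟩
    d z x         ∎
    where open ≡-Reasoning

  gp-⊆ᴸ-triple : (∀ u v → d u v ≡ d v u) → ∀ {S x y z} → NondegenerateTriangle (d x y) (d y z) (d x z) →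
    S ⊆ᴸ (x ∷ y ∷ z ∷ []) → IsGeneralPosition G S
  gp-⊆ᴸ-triple d-sym {S} {x} {y} {z} (xy≢yz+xz , yz≢xy+xz , xz≢xy+yz) S⊆xyz = none-between⇒gp S none
    where
    ¬yxz : ¬ Between y x z
    ¬yxz yxz = yz≢xy+xz (trans (sym yxz) (cong (_+ d x z) (d-sym y x)))
    ¬xyz : ¬ Between x y z
    ¬xyz xyz = xz≢xy+yz (sym xyz)
    ¬xzy : ¬ Between x z y
    ¬xzy xzy = xy≢yz+xz (trans (sym xzy) (trans (cong (d x z +_) (d-sym z y)) (+-comm (d x z) (d y z))))
    none : NoneBetween S
    none a∈S b∈S c∈S a≢b a≢c b≢c with S⊆xyz a∈S | S⊆xyz b∈S | S⊆xyz c∈S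
    ... | first  | first  | _      = ⊥-elim (a≢b refl)
    ... | second | second | _      = ⊥-elim (a≢b refl)
    ... | third  | third  | _      = ⊥-elim (a≢b refl)
    ... | first  | _      | first  = ⊥-elim (a≢c refl)
    ... | second | _      | second = ⊥-elim (a≢c refl)
    ... | third  | _      | third  = ⊥-elim (a≢c refl)
    ... | _      | first  | first  = ⊥-elim (b≢c refl)
    ... | _      | second | second = ⊥-elim (b≢c refl)
    ... | _      | third  | third  = ⊥-elim (b≢c refl)
    ... | second | first  | third  = ¬yxz
    ... | third  | first  | second = ¬yxz ∘ between-sym d-sym
    ... | first  | second | third  = ¬xyz
    ... | third  | second | first  = ¬xyz ∘ between-sym d-sym
    ... | first  | third  | second = ¬xzy
    ... | second | third  | first  = ¬xzy ∘ between-sym d-sym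

  between⇒≢ : ∀ {x y z} → Between x y z → x ≢ y → x ≢ z
  between⇒≢ {x} {y} xyx x≢y refl = x≢y (d≡0⇒≡ (m+n≡0⇒m≡0 (d x y) (trans xyx (d-refl x))))

  between-members⇒maximal : ∀ {xs} → IsGeneralPosition G (fromList xs) →
    (∀ {y} → ¬ y L.∈ xs → ∃ λ x → ∃ λ z → x L.∈ xs × z L.∈ xs × Between x y z) →
    IsMaximalGP G (fromList xs)
  between-members⇒maximal {xs} gp between = gp , maximal
    where
    maximal : ∀ T → IsGeneralPosition G T → fromList xs ⊆ T → T ⊆ fromList xs
    maximal T gpT xs⊆T {y} y∈T with Any.any? (y F.≟_) xs
    ... | yes y∈xs = ∈-fromList⁺ y∈xs
    ... | no  y∉xs with between y∉xs
    ...   | x , z , x∈xs , z∈xs , xyz =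
      ⊥-elim (gp⇒none-between gpT (xs⊆T (∈-fromList⁺ x∈xs)) y∈T (xs⊆T (∈-fromList⁺ z∈xs))
                x≢y (between⇒≢ xyz x≢y) (λ { refl → y∉xs z∈xs }) xyz)
      where
      x≢y : x ≢ y
      x≢y refl = y∉xs x∈xs

-- Complete multipartite graphs

module CompleteMultipartite {N t : ℕ} (p : Fin N → Fin t) (2≤t : 2 ≤ t)
  (parts≥2 : ∀ i → 2 ≤ ∣ partSet p i ∣) where

  ∈-part⁺ : ∀ {v i} → p v ≡ i → v ∈ partSet p i
  ∈-part⁺ = ∈-decSubset⁺ (λ v → p v F.≟ _)

  ∈-part⁻ : ∀ {v i} → v ∈ partSet p i → p v ≡ i
  ∈-part⁻ = ∈-decSubset⁻ (λ v → p v F.≟ _)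

  representative : ∀ i → ∃ λ v → p v ≡ i
  representative i with two-members (parts≥2 i)
  ... | v , _ , v∈i , _ = v , ∈-part⁻ v∈i

  d : Fin N → Fin N → ℕ
  d u v with u F.≟ v | p u F.≟ p v
  ... | yes _ | _     = 0
  ... | no  _ | yes _ = 2
  ... | no  _ | no  _ = 1

  d-same-part : ∀ {u v} → u ≢ v → p u ≡ p v → d u v ≡ 2
  d-same-part {u} {v} u≢v pu≡pv with u F.≟ v | p u F.≟ p v
  ... | yes u≡v | _          = ⊥-elim (u≢v u≡v)
  ... | no  _   | yes _      = refl
  ... | no  _   | no  pu≢pv = ⊥-elim (pu≢pv pu≡pv)

  d-other-part : ∀ {u v} → p u ≢ p v → d u v ≡ 1
  d-other-part {u} {v} pu≢pv with u F.≟ v | p u F.≟ p v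
  ... | yes refl | _          = ⊥-elim (pu≢pv refl)
  ... | no  _    | yes pu≡pv = ⊥-elim (pu≢pv pu≡pv)
  ... | no  _    | no  _      = refl

  d≤2 : ∀ u v → d u v ≤ 2
  d≤2 u v with u F.≟ v | p u F.≟ p v
  ... | yes _ | _     = z≤n
  ... | no  _ | yes _ = ≤-refl
  ... | no  _ | no  _ = s≤s z≤n

  d≥1 : ∀ {u v} → u ≢ v → 1 ≤ d u v
  d≥1 {u} {v} u≢v with u F.≟ v | p u F.≟ p v
  ... | yes u≡v | _     = ⊥-elim (u≢v u≡v)
  ... | no  _   | yes _ = s≤s z≤n
  ... | no  _   | no  _ = s≤s z≤n

  d≤length : ∀ {u w} xs → IsWalk (Multipartite p) u w xs → d u w ≤ length xs
  d≤length {u} []          (_ , refl) with u F.≟ u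
  ... | yes _   = z≤n
  ... | no  u≢u = ⊥-elim (u≢u refl)
  d≤length (x ∷ [])     (pu≢px ∷ _ , refl) = ≤-reflexive (d-other-part pu≢px)
  d≤length {u} {w} (_ ∷ _ ∷ _) _ = ≤-trans (d≤2 u w) (s≤s (s≤s z≤n))

  -- two vertices of the same part are joined through any vertex of another part
  walk≤d : ∀ u w → ∃ λ xs → IsWalk (Multipartite p) u w xs × length xs ≤ d u w
  walk≤d u w with u F.≟ w | p u F.≟ p w
  ... | yes u≡w | _          = [] , ([-] , u≡w) , ≤-refl
  ... | no  _   | no  pu≢pw = w ∷ [] , (pu≢pw ∷ [-] , refl) , ≤-refl
  ... | no  _   | yes pu≡pw with other-vertex 2≤t (p u)
  ...   | j , j≢pu with representative j
  ...     | y , refl =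
    y ∷ w ∷ [] , ((≢-sym j≢pu ∷ (λ j≡pw → j≢pu (trans j≡pw (sym pu≡pw))) ∷ [-]) , refl) , ≤-refl

  open GraphDistance (Multipartite p) d d≤length walk≤d

  -- equivalently: S lies inside one part or meets every part at most once
  Confined : Subset N → Set
  Confined S = ∀ {x y z} → x ∈ S → y ∈ S → z ∈ S → x ≢ z → p x ≡ p z → p x ≡ p y

  confined⇒gp : ∀ {S} → Confined S → IsGeneralPosition (Multipartite p) S
  confined⇒gp {S} confined = none-between⇒gp S none
    where
    none : NoneBetween S
    none {x} {y} {z} x∈S y∈S z∈S x≢y x≢z y≢z xyz = by-parts (p x F.≟ p z)
      where
      by-parts : Dec (p x ≡ p z) → ⊥
      by-parts (no  px≢pz) = <⇒≱ (+-mono-≤ (d≥1 x≢y) (d≥1 y≢z)) (≤-reflexive (trans xyz (d-other-part px≢pz)))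
      by-parts (yes px≡pz) =
        <⇒≱ (+-mono-≤ (≤-reflexive (sym (d-same-part x≢y (confined x∈S y∈S z∈S x≢z px≡pz)))) (d≥1 y≢z))
            (≤-trans (≤-reflexive xyz) (d≤2 x z))

  gp⇒confined : ∀ {S} → IsGeneralPosition (Multipartite p) S → Confined S
  gp⇒confined gp {x} {y} {z} x∈S y∈S z∈S x≢z px≡pz with p x F.≟ p y
  ... | yes px≡py = px≡py
  ... | no  px≢py = ⊥-elim (gp⇒none-between gp x∈S y∈S z∈S (px≢py ∘ cong p) x≢z (py≢pz ∘ cong p) (begin
    d x y + d y z ≡⟨ cong₂ _+_ (d-other-part px≢py) (d-other-part py≢pz) ⟩
    2             ≡⟨ d-same-part x≢z px≡pz ⟨
    d x z         ∎))
    where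
    open ≡-Reasoning
    py≢pz : p y ≢ p z
    py≢pz py≡pz = px≢py (trans px≡pz (sym py≡pz))

  within-part⇒confined : ∀ {S i} → (∀ {x} → x ∈ S → p x ≡ i) → Confined S
  within-part⇒confined in-i x∈S y∈S _ _ _ = trans (in-i x∈S) (sym (in-i y∈S))

  parts-distinct⇒confined : ∀ {S} → (∀ {x z} → x ∈ S → z ∈ S → x ≢ z → p x ≢ p z) → Confined S
  parts-distinct⇒confined distinct x∈S _ z∈S x≢z px≡pz = ⊥-elim (distinct x∈S z∈S x≢z px≡pz)

  part-maximal : ∀ i → IsMaximalGP (Multipartite p) (partSet p i)
  part-maximal i = confined⇒gp (within-part⇒confined ∈-part⁻) , maximal
    where
    maximal : ∀ T → IsGeneralPosition (Multipartite p) T → partSet p i ⊆ T → T ⊆ partSet p i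
    maximal T gp part⊆T x∈T with two-members (parts≥2 i)
    ... | a , b , a∈i , b∈i , a≢b =
      ∈-part⁺ (trans (sym (gp⇒confined gp (part⊆T a∈i) x∈T (part⊆T b∈i) a≢b pa≡pb)) (∈-part⁻ a∈i))
      where
      pa≡pb : p a ≡ p b
      pa≡pb = trans (∈-part⁻ a∈i) (sym (∈-part⁻ b∈i))

  rep : Fin t → Fin N
  rep i = proj₁ (representative i)

  p∘rep : ∀ i → p (rep i) ≡ i
  p∘rep i = proj₂ (representative i)

  transversal : Subset N
  transversal = decSubset (λ v → v F.≟ rep (p v))

  rep∈transversal : ∀ i → rep i ∈ transversal
  rep∈transversal i = ∈-decSubset⁺ (λ v → v F.≟ rep (p v)) (cong rep (sym (p∘rep i)))

  ∣transversal∣ : ∣ transversal ∣ ≡ t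
  ∣transversal∣ = ≤-antisym
    (subst (∣ transversal ∣ ≤_) (length-tabulate rep) (∣p∣≤length (tabulate rep) transversal⊆reps))
    (injective⇒≤∣p∣ rep rep-injective rep∈transversal)
    where
    transversal⊆reps : transversal ⊆ᴸ tabulate rep
    transversal⊆reps {x} x∈tr =
      subst (L._∈ tabulate rep) (sym (∈-decSubset⁻ (λ v → v F.≟ rep (p v)) x∈tr)) (∈-tabulate⁺ (p x))
    rep-injective : ∀ {i j} → rep i ≡ rep j → i ≡ j
    rep-injective {i} {j} eq = trans (sym (p∘rep i)) (trans (cong p eq) (p∘rep j))

  transversal-maximal : IsMaximalGP (Multipartite p) transversal
  transversal-maximal = confined⇒gp (parts-distinct⇒confined distinct) , maximal
    where
    is-rep : ∀ {x} → x ∈ transversal → x ≡ rep (p x)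
    is-rep = ∈-decSubset⁻ (λ v → v F.≟ rep (p v))
    distinct : ∀ {x z} → x ∈ transversal → z ∈ transversal → x ≢ z → p x ≢ p z
    distinct x∈tr z∈tr x≢z px≡pz = x≢z (trans (is-rep x∈tr) (trans (cong rep px≡pz) (sym (is-rep z∈tr))))
    maximal : ∀ T → IsGeneralPosition (Multipartite p) T → transversal ⊆ T → T ⊆ transversal
    maximal T gp tr⊆T {x} x∈T with x F.≟ rep (p x) | other-vertex 2≤t (p x)
    ... | yes x≡rep | _ = ∈-decSubset⁺ (λ v → v F.≟ rep (p v)) x≡rep
    ... | no  x≢rep | j , j≢px = ⊥-elim (j≢px (sym (trans
          (gp⇒confined gp x∈T (tr⊆T (rep∈transversal j)) (tr⊆T (rep∈transversal (p x))) x≢rep (sym (p∘rep (p x))))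
          (p∘rep j))))

  maximal⇒part-or-transversal : ∀ {S} → IsMaximalGP (Multipartite p) S →
    (∃ λ i → partSet p i ⊆ S) ⊎ (∀ i → ∃ λ v → v ∈ S × p v ≡ i)
  maximal⇒part-or-transversal {S} maxS@(gp , _)
    with FP.any? (λ x → FP.any? (λ z → x ∈? S ×-dec z ∈? S ×-dec ¬? (x F.≟ z) ×-dec p x F.≟ p z))
  ... | yes (a , b , a∈S , b∈S , a≢b , pa≡pb) = inj₁ (p a , part⊆S)
    where
    part⊆S : partSet p (p a) ⊆ S
    part⊆S {v} v∈part = maximal-absorbs maxS (confined⇒gp (within-part⇒confined in-part))
      where
      in-part : ∀ {x} → x ∈ S ∪ ⁅ v ⁆ → p x ≡ p a
      in-part {x} x∈S∪v with x∈p∪q⁻ S ⁅ v ⁆ x∈S∪v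
      ... | inj₁ x∈S = sym (gp⇒confined gp a∈S x∈S b∈S a≢b pa≡pb)
      ... | inj₂ x∈v = trans (cong p (x∈⁅y⁆⇒x≡y v x∈v)) (∈-part⁻ v∈part)
  ... | no ∄pair = inj₂ meets
    where
    meets : ∀ i → ∃ λ v → v ∈ S × p v ≡ i
    meets i with FP.any? (λ v → v ∈? S ×-dec p v F.≟ i)
    ... | yes hit = hit
    ... | no  ∄hit = ⊥-elim (∄hit (rep i , rep∈S , p∘rep i))
      where
      distinct : ∀ {x z} → x ∈ S ∪ ⁅ rep i ⁆ → z ∈ S ∪ ⁅ rep i ⁆ → x ≢ z → p x ≢ p z
      distinct {x} {z} x∈ z∈ x≢z px≡pz with x∈p∪q⁻ S ⁅ rep i ⁆ x∈ | x∈p∪q⁻ S ⁅ rep i ⁆ z∈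
      ... | inj₁ x∈S | inj₁ z∈S = ∄pair (x , z , x∈S , z∈S , x≢z , px≡pz)
      ... | inj₁ x∈S | inj₂ z∈r = ∄hit (x , x∈S , trans px≡pz (trans (cong p (x∈⁅y⁆⇒x≡y _ z∈r)) (p∘rep i)))
      ... | inj₂ x∈r | inj₁ z∈S = ∄hit (z , z∈S , trans (sym px≡pz) (trans (cong p (x∈⁅y⁆⇒x≡y _ x∈r)) (p∘rep i)))
      ... | inj₂ x∈r | inj₂ z∈r = x≢z (trans (x∈⁅y⁆⇒x≡y _ x∈r) (sym (x∈⁅y⁆⇒x≡y _ z∈r)))
      rep∈S : rep i ∈ S
      rep∈S = maximal-absorbs maxS (confined⇒gp (parts-distinct⇒confined distinct))

  gp⁻ : ∀ ℓ → (∀ i → ∣ partSet p ℓ ∣ ≤ ∣ partSet p i ∣) → GpMinusIs (Multipartite p) (t ⊓ ∣ partSet p ℓ ∣)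
  gp⁻ ℓ ℓ-smallest = smallest-maximal , lower-bound
    where
    smallest-maximal : ∃ λ S → IsMaximalGP (Multipartite p) S × ∣ S ∣ ≡ t ⊓ ∣ partSet p ℓ ∣
    smallest-maximal with ∣ partSet p ℓ ∣ ≤? t
    ... | yes ℓ≤t = partSet p ℓ , part-maximal ℓ , sym (m≥n⇒m⊓n≡n ℓ≤t)
    ... | no  ℓ≰t = transversal , transversal-maximal , trans ∣transversal∣ (sym (m≤n⇒m⊓n≡m (<⇒≤ (≰⇒> ℓ≰t))))
    lower-bound : ∀ S → IsMaximalGP (Multipartite p) S → t ⊓ ∣ partSet p ℓ ∣ ≤ ∣ S ∣
    lower-bound S maxS with maximal⇒part-or-transversal maxS
    ... | inj₁ (i , part⊆S) = ≤-trans (m⊓n≤n t _) (≤-trans (ℓ-smallest i) (p⊆q⇒∣p∣≤∣q∣ part⊆S))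
    ... | inj₂ meets = ≤-trans (m⊓n≤m t _) (injective⇒≤∣p∣ hit hit-injective (proj₁ ∘ proj₂ ∘ meets))
      where
      hit : Fin t → Fin N
      hit = proj₁ ∘ meets
      hit-injective : ∀ {i j} → hit i ≡ hit j → i ≡ j
      hit-injective {i} {j} eq = trans (sym (proj₂ (proj₂ (meets i)))) (trans (cong p eq) (proj₂ (proj₂ (meets j))))

-- Cycles

module _ where
  open import Data.Nat using (∣_-_∣)

  ∣n-1+n∣≡1 : ∀ a → ∣ a - suc a ∣ ≡ 1
  ∣n-1+n∣≡1 a = trans (cong ∣ a -_∣ (+-comm 1 a)) (∣m-m+n∣≡n a 1)

  ∣-∣-adjacent : ∀ a w → ∣ a - w ∣ ≤ suc ∣ suc a - w ∣ × ∣ suc a - w ∣ ≤ suc ∣ a - w ∣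
  ∣-∣-adjacent a w =
    subst (λ k → ∣ a - w ∣ ≤ k + ∣ suc a - w ∣) (∣n-1+n∣≡1 a) (∣-∣-triangle a (suc a) w) ,
    subst (λ k → ∣ suc a - w ∣ ≤ k + ∣ a - w ∣) (trans (∣-∣-comm (suc a) a) (∣n-1+n∣≡1 a)) (∣-∣-triangle (suc a) a w)

arc-triangle : ∀ {x y m} → x + y ≡ suc m → NondegenerateTriangle x y m
arc-triangle {x} {y} {m} x+y≡1+m =
  not-sum x+y≡1+m , not-sum (trans (+-comm y x) x+y≡1+m) , λ m≡x+y → 1+n≢n (trans (sym x+y≡1+m) (sym m≡x+y))
  where
  double≢1 : ∀ k → k + k ≢ 1
  double≢1 (suc k) 2+2k≡1 = 1+n≢0 (trans (sym (+-suc k k)) (suc-injective 2+2k≡1))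
  not-sum : ∀ {x y} → x + y ≡ suc m → x ≢ y + m
  not-sum {y = y} y+m+y≡1+m refl = double≢1 y (+-cancelʳ-≡ m (y + y) 1 (begin
    y + y + m   ≡⟨ +-assoc y y m ⟩
    y + (y + m) ≡⟨ cong (y +_) (+-comm y m) ⟩
    y + (m + y) ≡⟨ +-assoc y m y ⟨
    y + m + y   ≡⟨ y+m+y≡1+m ⟩
    suc m       ∎))
    where open ≡-Reasoning

n+m≢n : ∀ n {m} → 1 ≤ m → n + m ≢ n
n+m≢n n {suc m} _ n+1+m≡n = m+1+n≰m n (≤-reflexive n+1+m≡n)

module CycleGraph (n : ℕ) (0<n : 0 < n) where
  open import Data.Nat using (∣_-_∣)

  -- number of edges of the shorter of the two arcs spanning e consecutive edges
  arc : ℕ → ℕ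
  arc e = e ⊓ (n ∸ e)

  D : ℕ → ℕ → ℕ
  D a b = arc ∣ a - b ∣

  d : Fin n → Fin n → ℕ
  d i j = D (toℕ i) (toℕ j)

  D-sym : ∀ a b → D a b ≡ D b a
  D-sym a b = cong arc (∣-∣-comm a b)

  d-sym : ∀ u w → d u w ≡ d w u
  d-sym u w = D-sym (toℕ u) (toℕ w)

  arc-adjacent : ∀ {δ δ′} → δ ≤ suc δ′ → δ′ ≤ suc δ → arc δ ≤ suc (arc δ′)
  arc-adjacent {δ} {δ′} δ≤1+δ′ δ′≤1+δ = ⊓-mono-≤ δ≤1+δ′ (m≤n+o⇒m∸n≤o n δ (begin
    n                 ≤⟨ m≤n+m∸n n δ′ ⟩
    δ′ + (n ∸ δ′)     ≤⟨ +-monoˡ-≤ (n ∸ δ′) δ′≤1+δ ⟩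
    suc δ + (n ∸ δ′)  ≡⟨ +-suc δ (n ∸ δ′) ⟨
    δ + suc (n ∸ δ′)  ∎))
    where open ≤-Reasoning

  D-adjacent : ∀ a w → D a w ≤ suc (D (suc a) w) × D (suc a) w ≤ suc (D a w)
  D-adjacent a w = let (down , up) = ∣-∣-adjacent a w in arc-adjacent down up , arc-adjacent up down

  D-wrap : ∀ a w → suc a ≡ n → w < n → D a w ≤ suc (D 0 w) × D 0 w ≤ suc (D a w)
  D-wrap a w refl (s≤s w≤a) =
    subst₂ (λ x y → x ≤ suc y × y ≤ suc x) (sym Daw) (sym D0w) (wrap (a ∸ w) w , wrap w (a ∸ w))
    where
    wrap : ∀ b w → b ⊓ suc w ≤ suc (w ⊓ suc b)
    wrap b w = ⊓-glb (m⊓n≤n b (suc w)) (≤-trans (m⊓n≤m b (suc w)) (≤-trans (n≤1+n b) (n≤1+n (suc b))))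
    Daw : D a w ≡ (a ∸ w) ⊓ suc w
    Daw = begin
      arc ∣ a - w ∣                 ≡⟨ cong arc (m≤n⇒∣n-m∣≡n∸m w≤a) ⟩
      (a ∸ w) ⊓ (suc a ∸ (a ∸ w))   ≡⟨ cong ((a ∸ w) ⊓_) (+-∸-assoc 1 (m∸n≤m a w)) ⟩
      (a ∸ w) ⊓ suc (a ∸ (a ∸ w))   ≡⟨ cong (λ k → (a ∸ w) ⊓ suc k) (m∸[m∸n]≡n w≤a) ⟩
      (a ∸ w) ⊓ suc w               ∎
      where open ≡-Reasoning
    D0w : D 0 w ≡ w ⊓ suc (a ∸ w)
    D0w = cong (w ⊓_) (+-∸-assoc 1 w≤a)

  d-neighbour : ∀ {u x} w → Cycle n u x → d u w ≤ suc (d x w)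
  d-neighbour {u} {x} w (inj₁ (inj₁ 1+u≡x)) =
    subst (λ k → d u w ≤ suc (D k (toℕ w))) 1+u≡x (proj₁ (D-adjacent (toℕ u) (toℕ w)))
  d-neighbour {u} {x} w (inj₂ (inj₁ 1+x≡u)) =
    subst (λ k → D k (toℕ w) ≤ suc (d x w)) 1+x≡u (proj₂ (D-adjacent (toℕ x) (toℕ w)))
  d-neighbour {u} {x} w (inj₁ (inj₂ (u-last , x≡0))) =
    subst (λ k → d u w ≤ suc (D k (toℕ w))) (sym x≡0) (proj₁ (D-wrap (toℕ u) (toℕ w) u-last (FP.toℕ<n w)))
  d-neighbour {u} {x} w (inj₂ (inj₂ (x-last , u≡0))) =
    subst (λ k → D k (toℕ w) ≤ suc (d x w)) (sym u≡0) (proj₂ (D-wrap (toℕ x) (toℕ w) x-last (FP.toℕ<n w)))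

  d≤length : ∀ {u w} xs → IsWalk (Cycle n) u w xs → d u w ≤ length xs
  d≤length {u} []       (_ , refl)         = ≤-reflexive (cong arc (∣n-n∣≡0 (toℕ u)))
  d≤length {u} {w} (x ∷ xs) (ux ∷ linked , xs-end) = ≤-trans (d-neighbour w ux) (s≤s (d≤length xs (linked , xs-end)))

  Walk : Fin n → Fin n → ℕ → Set
  Walk u w k = ∃ λ xs → IsWalk (Cycle n) u w xs × length xs ≡ k

  walk-cast : ∀ {u w k k′} → k ≡ k′ → Walk u w k → Walk u w k′
  walk-cast refl walk = walk

  walk-∷ : ∀ {u x w k} → Cycle n u x → Walk x w k → Walk u w (suc k)
  walk-∷ {x = x} ux (xs , (linked , xs-end) , refl) = x ∷ xs , (ux ∷ linked , xs-end) , refl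

  walk-++ : ∀ {u v w k k′} → Walk u v k → Walk v w k′ → Walk u w (k + k′)
  walk-++ (xs , xs-walk , refl) (ys , ys-walk , refl) = xs ++ ys , IsWalk-++ (Cycle n) xs ys xs-walk ys-walk , length-++ xs

  vertex : ∀ k → k < n → Fin n
  vertex k k<n = F.fromℕ< k<n

  toℕ-vertex : ∀ k k<n → toℕ (vertex k k<n) ≡ k
  toℕ-vertex k k<n = FP.toℕ-fromℕ< k<n

  walk-up : ∀ e {u w} → toℕ u + e ≡ toℕ w → Walk u w e
  walk-up zero    {u} {w} u+0≡w = [] , ([-] , FP.toℕ-injective (trans (sym (+-identityʳ (toℕ u))) u+0≡w)) , refl
  walk-up (suc e) {u} {w} u+1+e≡w =
    walk-∷ (inj₁ (inj₁ (sym (toℕ-vertex _ 1+u<n))))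
           (walk-up e (trans (cong (_+ e) (toℕ-vertex _ 1+u<n)) (trans (sym (+-suc (toℕ u) e)) u+1+e≡w)))
    where
    1+u<n : suc (toℕ u) < n
    1+u<n = ≤-<-trans (≤-trans (s≤s (m≤m+n (toℕ u) e)) (≤-reflexive (trans (sym (+-suc (toℕ u) e)) u+1+e≡w)))
                      (FP.toℕ<n w)

  walk-down : ∀ e {u w} → toℕ w + e ≡ toℕ u → Walk u w e
  walk-down zero    {u} {w} w+0≡u = [] , ([-] , FP.toℕ-injective (sym (trans (sym (+-identityʳ (toℕ w))) w+0≡u))) , refl
  walk-down (suc e) {u} {w} w+1+e≡u =
    walk-∷ (inj₂ (inj₁ (trans (cong suc (toℕ-vertex _ w+e<n)) (trans (sym (+-suc (toℕ w) e)) w+1+e≡u))))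
           (walk-down e (sym (toℕ-vertex _ w+e<n)))
    where
    w+e<n : toℕ w + e < n
    w+e<n = ≤-<-trans (≤-trans (n≤1+n _) (≤-reflexive (trans (sym (+-suc (toℕ w) e)) w+1+e≡u))) (FP.toℕ<n u)

  first-vertex : Fin n
  first-vertex = vertex 0 0<n

  toℕ-first-vertex : toℕ first-vertex ≡ 0
  toℕ-first-vertex = toℕ-vertex 0 0<n

  1+[n∸1]≡n : suc (n ∸ 1) ≡ n
  1+[n∸1]≡n = m+[n∸m]≡n 0<n

  last-vertex : Fin n
  last-vertex = vertex (n ∸ 1) (≤-reflexive 1+[n∸1]≡n)

  toℕ-last-vertex : toℕ last-vertex ≡ n ∸ 1
  toℕ-last-vertex = toℕ-vertex (n ∸ 1) (≤-reflexive 1+[n∸1]≡n)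

  last→first : Cycle n last-vertex first-vertex
  last→first = inj₁ (inj₂ (trans (cong suc toℕ-last-vertex) 1+[n∸1]≡n , toℕ-first-vertex))

  first→last : Cycle n first-vertex last-vertex
  first→last = inj₂ (inj₂ (trans (cong suc toℕ-last-vertex) 1+[n∸1]≡n , toℕ-first-vertex))

  toℕ-last : ∀ {k} → suc k ≡ n → k ≡ toℕ last-vertex
  toℕ-last 1+k≡n = trans (suc-injective (trans 1+k≡n (sym 1+[n∸1]≡n))) (sym toℕ-last-vertex)

  wrap-down : ∀ u w f → suc (toℕ w + f) ≡ n → Walk u w (toℕ u + suc f)
  wrap-down u w f w+1+f≡n =
    walk-++ (walk-down (toℕ u) (cong (_+ toℕ u) toℕ-first-vertex))
            (walk-∷ first→last (walk-down f (toℕ-last w+1+f≡n)))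

  wrap-up : ∀ u w f → suc (toℕ u + f) ≡ n → Walk u w (f + suc (toℕ w))
  wrap-up u w f u+1+f≡n =
    walk-++ (walk-up f (toℕ-last u+1+f≡n))
            (walk-∷ last→first (walk-up (toℕ w) (cong (_+ toℕ w) toℕ-first-vertex)))

  WalkWithin : Fin n → Fin n → ℕ → Set
  WalkWithin u w k = ∃ λ xs → IsWalk (Cycle n) u w xs × length xs ≤ k

  shorter-arc : ∀ {u w} e → Walk u w e → Walk u w (n ∸ e) → WalkWithin u w (arc e)
  shorter-arc e (xs , xs-walk , xs≡e) (ys , ys-walk , ys≡n∸e) with e ≤? n ∸ e
  ... | yes e≤n∸e = xs , xs-walk , ≤-reflexive (trans xs≡e (sym (m≤n⇒m⊓n≡m e≤n∸e)))
  ... | no  e≰n∸e = ys , ys-walk , ≤-reflexive (trans ys≡n∸e (sym (m≥n⇒m⊓n≡n (<⇒≤ (≰⇒> e≰n∸e)))))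

  -- the two ways round the cycle from u to w, of lengths e and n ∸ e
  walk≤d : ∀ u w → WalkWithin u w (d u w)
  walk≤d u w with toℕ u ≤? toℕ w
  ... | yes u≤w = subst (WalkWithin u w ∘ arc) (sym (m≤n⇒∣m-n∣≡n∸m u≤w))
    (shorter-arc e (walk-up e u+e≡w) (walk-cast (sym n∸e≡) (wrap-down u w f w+1+f≡n)))
    where
    e = toℕ w ∸ toℕ u
    f = n ∸ suc (toℕ w)
    u+e≡w : toℕ u + e ≡ toℕ w
    u+e≡w = m+[n∸m]≡n u≤w
    w+1+f≡n : suc (toℕ w + f) ≡ n
    w+1+f≡n = m+[n∸m]≡n (FP.toℕ<n w)
    n∸e≡ : n ∸ e ≡ toℕ u + suc f
    n∸e≡ = begin
      n ∸ e                   ≡⟨ cong (_∸ e) (sym w+1+f≡n) ⟩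
      suc (toℕ w + f) ∸ e     ≡⟨ cong (λ k → suc (k + f) ∸ e) (sym u+e≡w) ⟩
      suc (toℕ u + e + f) ∸ e ≡⟨ cong (_∸ e) (shuffle (toℕ u) e f) ⟩
      e + (toℕ u + suc f) ∸ e ≡⟨ m+n∸m≡n e (toℕ u + suc f) ⟩
      toℕ u + suc f           ∎
      where
      open ≡-Reasoning
      shuffle : ∀ a e f → suc (a + e + f) ≡ e + (a + suc f)
      shuffle = solve-∀
  ... | no  u≰w = subst (WalkWithin u w ∘ arc) (sym (m≤n⇒∣n-m∣≡n∸m w≤u))
    (shorter-arc e (walk-down e w+e≡u) (walk-cast (sym n∸e≡) (wrap-up u w f u+1+f≡n)))
    where
    w≤u : toℕ w ≤ toℕ u
    w≤u = <⇒≤ (≰⇒> u≰w)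
    e = toℕ u ∸ toℕ w
    f = n ∸ suc (toℕ u)
    w+e≡u : toℕ w + e ≡ toℕ u
    w+e≡u = m+[n∸m]≡n w≤u
    u+1+f≡n : suc (toℕ u + f) ≡ n
    u+1+f≡n = m+[n∸m]≡n (FP.toℕ<n u)
    n∸e≡ : n ∸ e ≡ f + suc (toℕ w)
    n∸e≡ = begin
      n ∸ e                   ≡⟨ cong (_∸ e) (sym u+1+f≡n) ⟩
      suc (toℕ u + f) ∸ e     ≡⟨ cong (λ k → suc (k + f) ∸ e) (sym w+e≡u) ⟩
      suc (toℕ w + e + f) ∸ e ≡⟨ cong (_∸ e) (shuffle (toℕ w) e f) ⟩
      e + (f + suc (toℕ w)) ∸ e ≡⟨ m+n∸m≡n e (f + suc (toℕ w)) ⟩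
      f + suc (toℕ w)         ∎
      where
      open ≡-Reasoning
      shuffle : ∀ b e f → suc (b + e + f) ≡ e + (f + suc b)
      shuffle = solve-∀

  open GraphDistance (Cycle n) d d≤length walk≤d public

  d-+ : ∀ {u w e} → toℕ u + e ≡ toℕ w → d u w ≡ arc e
  d-+ {u} {w} {e} u+e≡w = trans (cong (λ k → arc ∣ toℕ u - k ∣) (sym u+e≡w)) (cong arc (∣m-m+n∣≡n (toℕ u) e))

  d-short : ∀ u w {e} → toℕ u + e ≡ toℕ w → e + e ≤ n → d u w ≡ e
  d-short _ _ {e} u+e≡w e+e≤n = trans (d-+ u+e≡w) (m≤n⇒m⊓n≡m (m+n≤o⇒m≤o∸n e e+e≤n))

  d-long : ∀ u w {e} → toℕ u + e ≡ toℕ w → n ≤ e + e → d u w ≡ n ∸ e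
  d-long _ _ {e} u+e≡w n≤e+e = trans (d-+ u+e≡w) (m≥n⇒m⊓n≡n (m≤n+o⇒m∸n≤o n e n≤e+e))

  -- An arc covering at most half of the cycle is a geodesic.
  between-first : ∀ {x w} → toℕ x ≤ toℕ w → toℕ w + toℕ w ≤ n → Between first-vertex x w
  between-first {x} {w} x≤w w+w≤n = begin
    d first-vertex x + d x w ≡⟨ cong₂ _+_ first-x x-w ⟩
    toℕ x + e                ≡⟨ x+e≡w ⟩
    toℕ w                    ≡⟨ first-w ⟨
    d first-vertex w         ∎
    where
    open ≡-Reasoning
    e = toℕ w ∸ toℕ x
    x+e≡w : toℕ x + e ≡ toℕ w
    x+e≡w = m+[n∸m]≡n x≤w
    first-x : d first-vertex x ≡ toℕ x
    first-x = d-short first-vertex x (cong (_+ toℕ x) toℕ-first-vertex) (≤-trans (+-mono-≤ x≤w x≤w) w+w≤n)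
    x-w : d x w ≡ e
    x-w = d-short x w x+e≡w (≤-trans (+-mono-≤ (m∸n≤m (toℕ w) (toℕ x)) (m∸n≤m (toℕ w) (toℕ x))) w+w≤n)
    first-w : d first-vertex w ≡ toℕ w
    first-w = d-short first-vertex w (cong (_+ toℕ w) toℕ-first-vertex) w+w≤n

  between-last : ∀ {w x} → toℕ w ≤ toℕ x → n ≤ toℕ w + toℕ w → Between w x first-vertex
  between-last {w} {x} w≤x n≤w+w = begin
    d w x + d x first-vertex          ≡⟨ cong₂ _+_ w-x (trans (d-sym x first-vertex) first-x) ⟩
    e + (n ∸ toℕ x)                   ≡⟨ m+n∸m≡n (toℕ w) (e + (n ∸ toℕ x)) ⟨
    toℕ w + (e + (n ∸ toℕ x)) ∸ toℕ w ≡⟨ cong (_∸ toℕ w) (+-assoc (toℕ w) e (n ∸ toℕ x)) ⟨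
    toℕ w + e + (n ∸ toℕ x) ∸ toℕ w   ≡⟨ cong (λ k → k + (n ∸ toℕ x) ∸ toℕ w) w+e≡x ⟩
    toℕ x + (n ∸ toℕ x) ∸ toℕ w       ≡⟨ cong (_∸ toℕ w) (m+[n∸m]≡n (<⇒≤ (FP.toℕ<n x))) ⟩
    n ∸ toℕ w                         ≡⟨ first-w ⟨
    d first-vertex w                  ≡⟨ d-sym first-vertex w ⟩
    d w first-vertex                  ∎
    where
    open ≡-Reasoning
    e = toℕ x ∸ toℕ w
    w+e≡x : toℕ w + e ≡ toℕ x
    w+e≡x = m+[n∸m]≡n w≤x
    e<w : e < toℕ w
    e<w = +-cancelˡ-< (toℕ w) e (toℕ w) (≤-trans (s≤s (≤-reflexive w+e≡x)) (≤-trans (FP.toℕ<n x) n≤w+w))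
    w-x : d w x ≡ e
    w-x = d-short w x w+e≡x (≤-trans (+-monoˡ-≤ e (<⇒≤ e<w)) (≤-trans (≤-reflexive w+e≡x) (<⇒≤ (FP.toℕ<n x))))
    first-x : d first-vertex x ≡ n ∸ toℕ x
    first-x = d-long first-vertex x (cong (_+ toℕ x) toℕ-first-vertex) (≤-trans n≤w+w (+-mono-≤ w≤x w≤x))
    first-w : d first-vertex w ≡ n ∸ toℕ w
    first-w = d-long first-vertex w (cong (_+ toℕ w) toℕ-first-vertex) n≤w+w

module EvenCycle (m : ℕ) (1≤m : 1 ≤ m) where

  open CycleGraph (m + m) (≤-trans 1≤m (m≤m+n m m))

  opposite : Fin (m + m)
  opposite = vertex m (m<m+n m 1≤m)

  toℕ-opposite : toℕ opposite ≡ m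
  toℕ-opposite = toℕ-vertex m (m<m+n m 1≤m)

  opposite+opposite≡n : toℕ opposite + toℕ opposite ≡ m + m
  opposite+opposite≡n = cong₂ _+_ toℕ-opposite toℕ-opposite

  first≢opposite : first-vertex ≢ opposite
  first≢opposite eq = <⇒≢ 1≤m (trans (sym toℕ-first-vertex) (trans (cong toℕ eq) toℕ-opposite))

  antipodes : List (Fin (m + m))
  antipodes = first-vertex ∷ opposite ∷ []

  between-antipodes : ∀ {y} → ¬ y L.∈ antipodes →
    ∃ λ x → ∃ λ z → x L.∈ antipodes × z L.∈ antipodes × Between x y z
  between-antipodes {y} y∉ with <-cmp (toℕ y) m
  ... | tri< y<m _ _ = first-vertex , opposite , first , second ,
    between-first (subst (toℕ y ≤_) (sym toℕ-opposite) (<⇒≤ y<m)) (≤-reflexive opposite+opposite≡n)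
  ... | tri≈ _ y≡m _ = ⊥-elim (y∉ (there (here (FP.toℕ-injective (trans y≡m (sym toℕ-opposite))))))
  ... | tri> _ _ m<y = opposite , first-vertex , second , first ,
    between-last (subst (_≤ toℕ y) (sym toℕ-opposite) (<⇒≤ m<y)) (≤-reflexive (sym opposite+opposite≡n))

  antipodes-maximal : IsMaximalGP (Cycle (m + m)) (fromList antipodes)
  antipodes-maximal = between-members⇒maximal (gp-⊆ᴸ-pair (fromList⊆ᴸ antipodes)) between-antipodes

  gp⁻ : GpMinusIs (Cycle (m + m)) 2
  gp⁻ = (fromList antipodes , antipodes-maximal , ∣fromList∣ ((first≢opposite ∷ []) ∷ [] ∷ [])) ,
        (λ _ → maximal-≥2 (+-mono-≤ 1≤m 1≤m))

module OddCycle (m : ℕ) (1≤m : 1 ≤ m) where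

  open CycleGraph (suc (m + m)) (s≤s z≤n)

  n : ℕ
  n = suc (m + m)

  m<n : m < n
  m<n = s≤s (m≤m+n m m)

  1+m<n : suc m < n
  1+m<n = s≤s (m<m+n m 1≤m)

  opposite₁ : Fin n
  opposite₁ = vertex m m<n

  opposite₂ : Fin n
  opposite₂ = vertex (suc m) 1+m<n

  toℕ-opposite₁ : toℕ opposite₁ ≡ m
  toℕ-opposite₁ = toℕ-vertex m m<n

  toℕ-opposite₂ : toℕ opposite₂ ≡ suc m
  toℕ-opposite₂ = toℕ-vertex (suc m) 1+m<n

  m+m≤n : m + m ≤ n
  m+m≤n = n≤1+n (m + m)

  n≤[1+m]+[1+m] : n ≤ suc m + suc m
  n≤[1+m]+[1+m] = s≤s (+-monoʳ-≤ m (n≤1+n m))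

  n∸[1+m]≡m : n ∸ suc m ≡ m
  n∸[1+m]≡m = m+n∸m≡n m m

  first-opposite₁ : d first-vertex opposite₁ ≡ m
  first-opposite₁ =
    d-short first-vertex opposite₁ (trans (cong (_+ m) toℕ-first-vertex) (sym toℕ-opposite₁)) m+m≤n

  opposite₁-opposite₂ : d opposite₁ opposite₂ ≡ 1
  opposite₁-opposite₂ =
    d-short opposite₁ opposite₂ (trans (cong (_+ 1) toℕ-opposite₁) (trans (+-comm m 1) (sym toℕ-opposite₂)))
            (s≤s (≤-trans 1≤m (m≤m+n m m)))

  first-opposite₂ : d first-vertex opposite₂ ≡ m
  first-opposite₂ = trans
    (d-long first-vertex opposite₂ (trans (cong (_+ suc m) toℕ-first-vertex) (sym toℕ-opposite₂)) n≤[1+m]+[1+m])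
    n∸[1+m]≡m

  antipodes : List (Fin n)
  antipodes = first-vertex ∷ opposite₁ ∷ opposite₂ ∷ []

  antipodes-unique : Unique antipodes
  antipodes-unique =
    (first≢opposite₁ ∷ first≢opposite₂ ∷ []) ∷ (opposite₁≢opposite₂ ∷ []) ∷ [] ∷ []
    where
    first≢opposite₁ : first-vertex ≢ opposite₁
    first≢opposite₁ eq = <⇒≢ 1≤m (trans (sym toℕ-first-vertex) (trans (cong toℕ eq) toℕ-opposite₁))
    first≢opposite₂ : first-vertex ≢ opposite₂
    first≢opposite₂ eq = 1+n≢0 (trans (sym toℕ-opposite₂) (trans (cong toℕ (sym eq)) toℕ-first-vertex))
    opposite₁≢opposite₂ : opposite₁ ≢ opposite₂
    opposite₁≢opposite₂ eq = 1+n≢n (trans (sym toℕ-opposite₂) (trans (cong toℕ (sym eq)) toℕ-opposite₁))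

  antipodes-gp : IsGeneralPosition (Cycle n) (fromList antipodes)
  antipodes-gp = gp-⊆ᴸ-triple d-sym nondegenerate (fromList⊆ᴸ antipodes)
    where
    nondegenerate : NondegenerateTriangle (d first-vertex opposite₁) (d opposite₁ opposite₂) (d first-vertex opposite₂)
    nondegenerate rewrite first-opposite₁ | opposite₁-opposite₂ | first-opposite₂ = arc-triangle (+-comm m 1)

  between-antipodes : ∀ {y} → ¬ y L.∈ antipodes →
    ∃ λ x → ∃ λ z → x L.∈ antipodes × z L.∈ antipodes × Between x y z
  between-antipodes {y} y∉ with <-cmp (toℕ y) m
  ... | tri< y<m _ _ = first-vertex , opposite₁ , first , second ,
    between-first (subst (toℕ y ≤_) (sym toℕ-opposite₁) (<⇒≤ y<m))
                  (subst (λ k → k + k ≤ n) (sym toℕ-opposite₁) m+m≤n)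
  ... | tri≈ _ y≡m _ = ⊥-elim (y∉ (there (here (FP.toℕ-injective (trans y≡m (sym toℕ-opposite₁))))))
  ... | tri> _ _ m<y = opposite₂ , first-vertex , third , first ,
    between-last (subst (_≤ toℕ y) (sym toℕ-opposite₂) m<y)
                 (subst (λ k → n ≤ k + k) (sym toℕ-opposite₂) n≤[1+m]+[1+m])

  antipodes-maximal : IsMaximalGP (Cycle n) (fromList antipodes)
  antipodes-maximal = between-members⇒maximal antipodes-gp between-antipodes

  module ShortGap {a b : Fin n} (a<b : toℕ a < toℕ b) (δ≤m : toℕ b ∸ toℕ a ≤ m) where
    δ = toℕ b ∸ toℕ a
    a+δ≡b : toℕ a + δ ≡ toℕ b
    a+δ≡b = m+[n∸m]≡n (<⇒≤ a<b)
    1≤δ : 1 ≤ δ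
    1≤δ = m<n⇒0<n∸m a<b
    g = suc m ∸ δ
    δ+g≡1+m : δ + g ≡ suc m
    δ+g≡1+m = m+[n∸m]≡n (m≤n⇒m≤1+n δ≤m)
    g≤m : g ≤ m
    g≤m = ∸-monoʳ-≤ (suc m) 1≤δ
    a-b : d a b ≡ δ
    a-b = d-short a b a+δ≡b (≤-trans (+-mono-≤ δ≤m δ≤m) m+m≤n)

  n∸m≡1+m : n ∸ m ≡ suc m
  n∸m≡1+m = trans (cong (_∸ m) (sym (+-suc m m))) (m+n∸m≡n m (suc m))

  ThirdVertex : Fin n → Fin n → Set
  ThirdVertex a b = ∃ λ c → c ≢ a × c ≢ b × NondegenerateTriangle (d a b) (d b c) (d a c)

  third-vertex-with : ∀ {a b c x y z} → toℕ c ≢ toℕ a → toℕ c ≢ toℕ b →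
    d a b ≡ x → d b c ≡ y → d a c ≡ z → NondegenerateTriangle x y z → ThirdVertex a b
  third-vertex-with {c = c} c≢a c≢b refl refl refl nondegenerate =
    c , c≢a ∘ cong toℕ , c≢b ∘ cong toℕ , nondegenerate

  -- b is at most m steps ahead of a: put c at distance m from a, away from b
  third-short-gap : ∀ {a b} → toℕ a < toℕ b → toℕ b ∸ toℕ a ≤ m → ThirdVertex a b
  third-short-gap {a} {b} a<b δ≤m with toℕ a + suc m <? n
  ... | yes a+1+m<n = third-vertex-with c≢a c≢b a-b b-c a-c (arc-triangle δ+g≡1+m)
    where
    open ShortGap a<b δ≤m
    c = vertex (toℕ a + suc m) a+1+m<n
    toℕ-c : toℕ c ≡ toℕ a + suc m
    toℕ-c = toℕ-vertex _ a+1+m<n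
    a-c : d a c ≡ m
    a-c = trans (d-long a c (sym toℕ-c) n≤[1+m]+[1+m]) n∸[1+m]≡m
    b+g≡c : toℕ b + g ≡ toℕ c
    b+g≡c = begin
      toℕ b + g         ≡⟨ cong (_+ g) a+δ≡b ⟨
      toℕ a + δ + g     ≡⟨ +-assoc (toℕ a) δ g ⟩
      toℕ a + (δ + g)   ≡⟨ cong (toℕ a +_) δ+g≡1+m ⟩
      toℕ a + suc m     ≡⟨ toℕ-c ⟨
      toℕ c             ∎
      where open ≡-Reasoning
    b-c : d b c ≡ g
    b-c = d-short b c b+g≡c (≤-trans (+-mono-≤ g≤m g≤m) m+m≤n)
    c≢a : toℕ c ≢ toℕ a
    c≢a c≡a = n+m≢n (toℕ a) (s≤s z≤n) (trans (sym toℕ-c) c≡a)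
    c≢b : toℕ c ≢ toℕ b
    c≢b c≡b = 1+n≰n (subst (_≤ m) (sym 1+m≡δ) δ≤m)
      where
      1+m≡δ : suc m ≡ δ
      1+m≡δ = +-cancelˡ-≡ (toℕ a) (suc m) δ (trans (sym toℕ-c) (trans c≡b (sym a+δ≡b)))
  ... | no a+1+m≮n = third-vertex-with c≢a c≢b a-b b-c a-c (arc-triangle δ+g≡1+m)
    where
    open ShortGap a<b δ≤m
    m≤a : m ≤ toℕ a
    m≤a = +-cancelʳ-≤ m m (toℕ a) (≤-pred (≤-trans (≮⇒≥ a+1+m≮n) (≤-reflexive (+-suc (toℕ a) m))))
    a∸m<n : toℕ a ∸ m < n
    a∸m<n = ≤-<-trans (m∸n≤m (toℕ a) m) (FP.toℕ<n a)
    c = vertex (toℕ a ∸ m) a∸m<n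
    toℕ-c : toℕ c ≡ toℕ a ∸ m
    toℕ-c = toℕ-vertex _ a∸m<n
    c+m≡a : toℕ c + m ≡ toℕ a
    c+m≡a = trans (cong (_+ m) toℕ-c) (m∸n+n≡m m≤a)
    a-c : d a c ≡ m
    a-c = trans (d-sym a c) (d-short c a c+m≡a m+m≤n)
    b-c : d b c ≡ g
    b-c = trans (d-sym b c) (trans
      (d-long c b (trans (sym (+-assoc (toℕ c) m δ)) (trans (cong (_+ δ) c+m≡a) a+δ≡b))
              (≤-trans (≤-reflexive (sym (+-suc m m))) (+-mono-≤ (m≤m+n m δ) (m<m+n m 1≤δ))))
      (trans (sym (∸-+-assoc n m δ)) (cong (_∸ δ) n∸m≡1+m)))
    c≢a : toℕ c ≢ toℕ a
    c≢a c≡a = n+m≢n (toℕ c) 1≤m (trans c+m≡a (sym c≡a))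
    c≢b : toℕ c ≢ toℕ b
    c≢b = <⇒≢ (≤-<-trans (subst (_≤ toℕ a) (sym toℕ-c) (m∸n≤m (toℕ a) m)) a<b)

  -- b is more than m steps ahead of a: put c between them, at distance m from b
  third-long-gap : ∀ {a b} → toℕ a < toℕ b → m < toℕ b ∸ toℕ a → ThirdVertex a b
  third-long-gap {a} {b} a<b m<δ = third-vertex-with c≢a c≢b a-b b-c a-c nondegenerate
    where
    δ = toℕ b ∸ toℕ a
    a+δ≡b : toℕ a + δ ≡ toℕ b
    a+δ≡b = m+[n∸m]≡n (<⇒≤ a<b)
    e = δ ∸ m
    m+e≡δ : m + e ≡ δ
    m+e≡δ = m+[n∸m]≡n (<⇒≤ m<δ)
    1≤e : 1 ≤ e
    1≤e = m<n⇒0<n∸m m<δ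
    e≤m : e ≤ m
    e≤m = +-cancelˡ-≤ m e m (subst (_≤ m + m) (sym m+e≡δ) (≤-trans (m∸n≤m (toℕ b) (toℕ a)) b≤m+m))
      where
      b≤m+m : toℕ b ≤ m + m
      b≤m+m = ≤-pred (FP.toℕ<n b)
    h = suc m ∸ e
    h+e≡1+m : h + e ≡ suc m
    h+e≡1+m = m∸n+n≡m (m≤n⇒m≤1+n e≤m)
    nondegenerate : NondegenerateTriangle h m e
    nondegenerate with arc-triangle h+e≡1+m
    ... | h≢e+m , e≢h+m , m≢h+e = (λ h≡m+e → h≢e+m (trans h≡m+e (+-comm m e))) , m≢h+e , e≢h+m
    a+e≤b : toℕ a + e ≤ toℕ b
    a+e≤b = ≤-trans (+-monoʳ-≤ (toℕ a) (m≤n+m e m)) (≤-reflexive (trans (cong (toℕ a +_) m+e≡δ) a+δ≡b))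
    a+e<n : toℕ a + e < n
    a+e<n = ≤-<-trans a+e≤b (FP.toℕ<n b)
    c = vertex (toℕ a + e) a+e<n
    toℕ-c : toℕ c ≡ toℕ a + e
    toℕ-c = toℕ-vertex _ a+e<n
    c+m≡b : toℕ c + m ≡ toℕ b
    c+m≡b = trans (cong (_+ m) toℕ-c) (trans (+-assoc (toℕ a) e m)
              (trans (cong (toℕ a +_) (trans (+-comm e m) m+e≡δ)) a+δ≡b))
    a-b : d a b ≡ h
    a-b = trans (d-long a b a+δ≡b (≤-trans n≤[1+m]+[1+m] (+-mono-≤ m<δ m<δ)))
                (trans (cong (n ∸_) (sym m+e≡δ)) (trans (sym (∸-+-assoc n m e)) (cong (_∸ e) n∸m≡1+m)))
    a-c : d a c ≡ e
    a-c = d-short a c (sym toℕ-c) (≤-trans (+-mono-≤ e≤m e≤m) m+m≤n)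
    b-c : d b c ≡ m
    b-c = trans (d-sym b c) (d-short c b c+m≡b m+m≤n)
    c≢a : toℕ c ≢ toℕ a
    c≢a c≡a = n+m≢n (toℕ a) 1≤e (trans (sym toℕ-c) c≡a)
    c≢b : toℕ c ≢ toℕ b
    c≢b c≡b = n+m≢n (toℕ c) 1≤m (trans c+m≡b (sym c≡b))

  third-vertex< : ∀ {a b} → toℕ a < toℕ b → ThirdVertex a b
  third-vertex< {a} {b} a<b with m <? toℕ b ∸ toℕ a
  ... | yes m<δ = third-long-gap a<b m<δ
  ... | no  m≮δ = third-short-gap a<b (≮⇒≥ m≮δ)

  third-vertex : ∀ {a b} → a ≢ b →
    ∃ λ c → c ≢ a × c ≢ b × ∀ {T} → T ⊆ᴸ (a ∷ b ∷ c ∷ []) → IsGeneralPosition (Cycle n) T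
  third-vertex {a} {b} a≢b with <-cmp (toℕ a) (toℕ b)
  ... | tri< a<b _ _ with third-vertex< a<b
  ...   | c , c≢a , c≢b , nondegenerate = c , c≢a , c≢b , gp-⊆ᴸ-triple d-sym nondegenerate
  third-vertex {a} {b} a≢b | tri≈ _ a≡b _ = ⊥-elim (a≢b (FP.toℕ-injective a≡b))
  third-vertex {a} {b} a≢b | tri> _ _ b<a with third-vertex< b<a
  ...   | c , c≢b , c≢a , nondegenerate =
    c , c≢a , c≢b , λ T⊆abc → gp-⊆ᴸ-triple d-sym nondegenerate (λ x∈T → swap-first-two (T⊆abc x∈T))
    where
    swap-first-two : ∀ {x} → x L.∈ (a ∷ b ∷ c ∷ []) → x L.∈ (b ∷ a ∷ c ∷ [])
    swap-first-two first  = second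
    swap-first-two second = first
    swap-first-two third  = third

  gp⁻ : GpMinusIs (Cycle n) 3
  gp⁻ = (fromList antipodes , antipodes-maximal , ∣fromList∣ antipodes-unique) ,
        (λ _ → maximal-≥3 (s≤s (≤-trans 1≤m (m≤m+n m m))) third-vertex)

halves : ∀ n → n ≡ n % 2 + (n / 2 + n / 2)
halves n = trans (m≡m%n+[m/n]*n n 2) (cong (n % 2 +_) (begin
  n / 2 * 2             ≡⟨ *-comm (n / 2) 2 ⟩
  n / 2 + (n / 2 + 0)   ≡⟨ cong (n / 2 +_) (+-identityʳ (n / 2)) ⟩
  n / 2 + n / 2         ∎))
  where open ≡-Reasoning

half-positive : ∀ k → 2 ≤ k + k → 1 ≤ k
half-positive (suc _) _ = s≤s z≤n

gp⁻-even-cycle : ∀ n → 2 ≤ n → n % 2 ≡ 0 → GpMinusIs (Cycle n) 2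
gp⁻-even-cycle n 2≤n n%2≡0 =
  subst (λ k → GpMinusIs (Cycle k) 2) (sym n≡k+k)
    (EvenCycle.gp⁻ (n / 2) (half-positive (n / 2) (subst (2 ≤_) n≡k+k 2≤n)))
  where
  n≡k+k : n ≡ n / 2 + n / 2
  n≡k+k = trans (halves n) (cong (_+ (n / 2 + n / 2)) n%2≡0)

gp⁻-odd-cycle : ∀ n → 3 ≤ n → n % 2 ≡ 1 → GpMinusIs (Cycle n) 3
gp⁻-odd-cycle n 3≤n n%2≡1 =
  subst (λ k → GpMinusIs (Cycle k) 3) (sym n≡1+k+k)
    (OddCycle.gp⁻ (n / 2) (half-positive (n / 2) (≤-pred (subst (3 ≤_) n≡1+k+k 3≤n))))
  where
  n≡1+k+k : n ≡ suc (n / 2 + n / 2)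
  n≡1+k+k = trans (halves n) (cong (_+ (n / 2 + n / 2)) n%2≡1)

proposition2p3 :
    (∀ (n : ℕ) → 3 ≤ n →
      (n % 2 ≡ 0 → GpMinusIs (Cycle n) 2) × (n % 2 ≡ 1 → GpMinusIs (Cycle n) 3))
    ×
    (∀ (t : ℕ) → 2 ≤ t → (r : Fin t → ℕ) →
      (∀ i j → toℕ i ≤ toℕ j → r j ≤ r i) → (∀ i → 2 ≤ r i) →
      ∀ (N : ℕ) (p : Fin N → Fin t) → (∀ i → ∣ partSet p i ∣ ≡ r i) →
      ∀ (last : Fin t) → toℕ last ≡ t ∸ 1 →
      GpMinusIs (Multipartite p) (t ⊓ r last))
proposition2p3 =
  (λ n 3≤n → gp⁻-even-cycle n (≤-trans (n≤1+n 2) 3≤n) , gp⁻-odd-cycle n 3≤n) ,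
  λ t 2≤t r r-antitone 2≤r N p ∣part∣≡r last last≡t∸1 →
    subst (λ k → GpMinusIs (Multipartite p) (t ⊓ k)) (∣part∣≡r last)
      (CompleteMultipartite.gp⁻ p 2≤t (λ i → subst (2 ≤_) (sym (∣part∣≡r i)) (2≤r i)) last
        (λ i → subst₂ _≤_ (sym (∣part∣≡r last)) (sym (∣part∣≡r i))
                 (r-antitone i last (subst (toℕ i ≤_) (sym last≡t∸1) (∸-monoˡ-≤ 1 (FP.toℕ<n i))))))
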